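{- For every integer $n\geqslant 0$, (i) $\displaystyle \sum_{k=0}^\infty p\left( n-k(6k+1)\right) = \frac{S_3(n)+G_3(n)+R(n)}{2}$; (ii) $\displaystyle \sum_{k=0}^\infty p\left( n-(2k+1)(3k+2)\right) = \frac{S_3(n)+G_3(n)-R(n)}{2}$.
   Context: $p(m)$ denotes the number of integer partitions of $m$, with $p(0)=1$ and $p(m)=0$ for $m<0$. For a partition $\lambda$ and $r\geqslant 1$, $g_r(\lambda)$ is the smallest positive integer whose multiplicity as a part of $\lambda$ is less than $r$ (multiplicity $0$ allowed). $S_3(n)=\sum_{\lambda\vdash n} g_3(\lambda)$. $G_3(n)$ is the number of partitions $\lambda$ of $n$ with $g_3(\lambda)<g_2(\lambda)$. $R(n)$ is the number of partitions of $n$ with nonnegative (Dyson) rank, where the rank of a partition is its largest part minus its number of parts. -}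

module Defs where

open import Data.Nat using (ℕ; zero; suc; _+_; _*_; _∸_; _<_; _≤_; _⊔_; _<ᵇ_; _≤ᵇ_; _≡ᵇ_)
open import Data.Integer using (ℤ; +_; -[1+_])
open import Data.Bool using (Bool; true; false; if_then_else_)
open import Data.List using (List; []; _∷_; length; map; concat; filter; foldr; upTo)
open import Data.Nat.ListAction using (sum)
open import Relation.Nullary.Decidable using (⌊_⌋)
import Data.Nat as ℕ

-- A partition is represented as a weakly decreasing list of positive parts.
-- partsAux fuel m b : all weakly decreasing lists of positive integers, each ≤ b,
-- summing to m (correct whenever fuel ≥ m).
partsAux : ℕ → ℕ → ℕ → List (List ℕ)
partsAux _ zero _ = [] ∷ []
partsAux zero (suc _) _ = []
partsAux (suc fuel) (suc m) b =
  concat (map (λ i → let j = suc i in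
                 if j ≤ᵇ suc m then map (j ∷_) (partsAux fuel (suc m ∸ j) j) else [])
              (upTo b))

partitions : ℕ → List (List ℕ)
partitions n = partsAux n n n

p : ℤ → ℕ
p (+ m) = length (partitions m)
p -[1+ _ ] = 0

mult : ℕ → List ℕ → ℕ
mult j [] = 0
mult j (x ∷ xs) = (if x ≡ᵇ j then 1 else 0) + mult j xs

gSearch : ℕ → ℕ → ℕ → List ℕ → ℕ
gSearch zero j r λ′ = j
gSearch (suc fuel) j r λ′ = if mult j λ′ <ᵇ r then j else gSearch fuel (suc j) r λ′

-- g_r(λ): smallest positive integer whose multiplicity in λ is < r.
-- (Some j ∈ {1,…,length λ + 1} has multiplicity 0, so the fuel suffices.)
g : ℕ → List ℕ → ℕ
g r λ′ = gSearch (suc (length λ′)) 1 r λ′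

S₃ : ℕ → ℕ
S₃ n = sum (map (g 3) (partitions n))

G₃ : ℕ → ℕ
G₃ n = length (filter (λ λ′ → g 3 λ′ ℕ.<? g 2 λ′) (partitions n))

largest : List ℕ → ℕ
largest = foldr _⊔_ 0

-- number of partitions of n with nonnegative rank (largest part ≥ number of parts)
R : ℕ → ℕ
R n = length (filter (λ λ′ → length λ′ ℕ.≤? largest λ′) (partitions n))

Σ≤ : ℕ → (ℕ → ℕ) → ℕ
Σ≤ N f = sum (map f (upTo (suc N)))

-- Let P(j) = j(3j+1)/2, so that P(2k) = k(6k+1) and P(2k+1) = (2k+1)(3k+2), and let A(n) and B(n) be the
-- sums in (i) and (ii). Both identities follow from R = A − B and S₃ + G₃ = A + B.
--
-- Deleting the first column of a partition (of length ℓ) and inserting ℓ − m − 1 as a new part is a bijection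
-- from the partitions of n + m + 1 with rank ≤ −m onto the partitions of n with rank > −(m + 3). So the number
-- N(m, n) of partitions of n with rank ≤ −m satisfies N(m, n + m + 1) + N(m + 3, n) = p(n); iterating from
-- m = 1, where the shifts 3j + 2 = P(j + 1) − P(j) accumulate to pentagonal numbers, gives
-- p(n) − R(n) = N(1, n) = Σ_{i ≥ 1} (−1)^(i−1) p(n − P(i)) = p(n) − A(n) + B(n).
--
-- P(j) is also the size of the multiset {1³, …, (j−1)³, j²}. Deleting it shows that exactly p(n − P(j))
-- partitions of n contain it, and a partition λ contains it iff j < g₃(λ), or j = g₃(λ) < g₂(λ). Counting the
-- pairs (λ, j) in both ways gives S₃(n) + G₃(n) = Σ_j p(n − P(j)) = A(n) + B(n).

module Submission where

open import Defs
open import Data.Nat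
open import Data.Nat.Properties
open import Data.Nat.ListAction using (sum)
open import Data.Nat.ListAction.Properties using (sum-++)
open import Data.Nat.Tactic.RingSolver using (solve-∀)
open import Algebra.Properties.CommutativeSemigroup +-commutativeSemigroup using (interchange; x∙yz≈y∙xz)
import Data.Integer as ℤ
import Data.Integer.Properties as ℤ
open import Data.Bool using (true; false; if_then_else_; T)
open import Data.Empty using (⊥-elim)
open import Data.Sum using (inj₁; inj₂)
open import Data.Product using (∃-syntax; _×_; _,_; proj₁; proj₂)
open import Data.List using (List; []; _∷_; [_]; _++_; length; map; filter; upTo; applyUpTo)
open import Data.List.Properties
  using (∷-injective; length-map; map-∘; map-id-local; map-cong-local; map-upTo; applyUpTo-∷ʳ;
         filter-all; filter-none; filter-≐)
open import Data.List.Membership.Propositional using (_∈_)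
open import Data.List.Membership.Propositional.Properties
  using (∈-map⁺; ∈-map⁻; ∈-filter⁺; ∈-filter⁻; ∈-concat⁺′; ∈-concat⁻′; ∈-upTo⁺; ∈-upTo⁻)
open import Data.List.Membership.Propositional.Properties.WithK using (unique∧set⇒bag)
open import Data.List.Membership.DecPropositional _≟_ using (_∈?_)
open import Data.List.Relation.Binary.BagAndSetEquality using (∼bag⇒↭)
open import Data.List.Relation.Binary.Disjoint.Propositional using (Disjoint)
open import Data.List.Relation.Binary.Permutation.Propositional.Properties using (↭-length)
open import Data.List.Relation.Unary.All as All using (All)
import Data.List.Relation.Unary.AllPairs as AllPairs
import Data.List.Relation.Unary.AllPairs.Properties as AllPairsₚ
open import Data.List.Relation.Unary.Any using (here; there)
open import Data.List.Relation.Unary.Unique.Propositional using (Unique)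
import Data.List.Relation.Unary.Unique.Propositional.Properties as Unique
open import Function using (_∘_)
open import Function.Bundles using (mk⇔)
open import Level using (0ℓ)
open import Relation.Nullary using (Dec; does; yes; no; ¬_)
open import Relation.Nullary.Decidable using (map′; _×-dec_)
open import Relation.Unary using (Pred; Decidable; ∁; _≐_)
open import Relation.Unary.Properties using (∁?)
open import Relation.Binary.PropositionalEquality hiding ([_])

length-≡-by-inverses : ∀ {a} {A B : Set a} {xs : List A} {ys : List B} (f : A → B) (g : B → A) →
  Unique xs → Unique ys →
  (∀ {x} → x ∈ xs → f x ∈ ys) → (∀ {y} → y ∈ ys → g y ∈ xs) →
  (∀ {x} → x ∈ xs → g (f x) ≡ x) → (∀ {y} → y ∈ ys → f (g y) ≡ y) →
  length xs ≡ length ys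
length-≡-by-inverses {xs = xs} {ys} f g xs! ys! f∈ g∈ gf fg = begin
  length xs          ≡⟨ length-map f xs ⟨
  length (map f xs)  ≡⟨ ↭-length (∼bag⇒↭ (unique∧set⇒bag fxs! ys! (mk⇔ to from))) ⟩
  length ys          ∎
  where
  open ≡-Reasoning
  fxs! : Unique (map f xs)
  fxs! = Unique.map⁻ {f = g} (subst Unique (sym (trans (sym (map-∘ xs)) (map-id-local (All.tabulate gf)))) xs!)
  to : ∀ {y} → y ∈ map f xs → y ∈ ys
  to y∈ with x , x∈ , refl ← ∈-map⁻ f y∈ = f∈ x∈
  from : ∀ {y} → y ∈ ys → y ∈ map f xs
  from y∈ = subst (_∈ map f xs) (fg y∈) (∈-map⁺ f (g∈ y∈))

length-filter-∁ : ∀ {A : Set} {P : Pred A 0ℓ} (P? : Decidable P) xs →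
  length (filter P? xs) + length (filter (∁? P?) xs) ≡ length xs
length-filter-∁ P? [] = refl
length-filter-∁ P? (x ∷ xs) with P? x
... | yes _ = cong suc (length-filter-∁ P? xs)
... | no  _ = trans (+-suc _ _) (cong suc (length-filter-∁ P? xs))

indicator : ∀ {P : Set} → Dec P → ℕ
indicator d = if does d then 1 else 0

indicator-yes : ∀ {P : Set} (d : Dec P) → P → indicator d ≡ 1
indicator-yes (yes _) _ = refl
indicator-yes (no ¬p) p = ⊥-elim (¬p p)

indicator-no : ∀ {P : Set} (d : Dec P) → ¬ P → indicator d ≡ 0
indicator-no (yes p) ¬p = ⊥-elim (¬p p)
indicator-no (no _)  _  = refl

indicator-⇔ : ∀ {P Q : Set} (p? : Dec P) (q? : Dec Q) → (P → Q) → (Q → P) → indicator p? ≡ indicator q?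
indicator-⇔ (yes p) (yes q) _  _  = refl
indicator-⇔ (yes p) (no ¬q) to _  = ⊥-elim (¬q (to p))
indicator-⇔ (no ¬p) (yes q) _ from = ⊥-elim (¬p (from q))
indicator-⇔ (no ¬p) (no ¬q) _  _  = refl

sum-map-indicator : ∀ {A : Set} {P : Pred A _} (P? : Decidable P) xs →
  sum (map (λ x → indicator (P? x)) xs) ≡ length (filter P? xs)
sum-map-indicator P? []       = refl
sum-map-indicator P? (x ∷ xs) with P? x
... | yes _ = cong suc (sum-map-indicator P? xs)
... | no  _ = sum-map-indicator P? xs

sum-map-+ : ∀ {A : Set} (f h : A → ℕ) xs → sum (map (λ x → f x + h x) xs) ≡ sum (map f xs) + sum (map h xs)
sum-map-+ f h []       = refl
sum-map-+ f h (x ∷ xs) = trans (cong (f x + h x +_) (sum-map-+ f h xs)) (interchange (f x) (h x) _ _)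

sum-applyUpTo-cong : ∀ {f g : ℕ → ℕ} N → (∀ k → f k ≡ g k) → sum (applyUpTo f N) ≡ sum (applyUpTo g N)
sum-applyUpTo-cong zero    f≗g = refl
sum-applyUpTo-cong (suc N) f≗g = cong₂ _+_ (f≗g 0) (sum-applyUpTo-cong N (f≗g ∘ suc))

sum-applyUpTo-zero : ∀ {f : ℕ → ℕ} N → (∀ k → f k ≡ 0) → sum (applyUpTo f N) ≡ 0
sum-applyUpTo-zero zero    f≗0 = refl
sum-applyUpTo-zero (suc N) f≗0 = cong₂ _+_ (f≗0 0) (sum-applyUpTo-zero N (f≗0 ∘ suc))

sum-applyUpTo-suc : ∀ (f : ℕ → ℕ) N → sum (applyUpTo f (suc N)) ≡ sum (applyUpTo f N) + f N
sum-applyUpTo-suc f N = begin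
  sum (applyUpTo f (suc N))        ≡⟨ cong sum (applyUpTo-∷ʳ f N) ⟨
  sum (applyUpTo f N ++ [ f N ])   ≡⟨ sum-++ (applyUpTo f N) [ f N ] ⟩
  sum (applyUpTo f N) + (f N + 0)  ≡⟨ cong (sum (applyUpTo f N) +_) (+-identityʳ (f N)) ⟩
  sum (applyUpTo f N) + f N        ∎
  where open ≡-Reasoning

sum-applyUpTo-+ : ∀ (f h : ℕ → ℕ) N → sum (applyUpTo (λ j → f j + h j) N) ≡ sum (applyUpTo f N) + sum (applyUpTo h N)
sum-applyUpTo-+ f h zero    = refl
sum-applyUpTo-+ f h (suc N) = trans (cong (f 0 + h 0 +_) (sum-applyUpTo-+ (f ∘ suc) (h ∘ suc) N)) (interchange (f 0) (h 0) _ _)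

sum-applyUpTo-step : ∀ {f : ℕ → ℕ} {a} N → a < N → (∀ j → j < a → f j ≡ 1) → (∀ j → a < j → f j ≡ 0) →
  sum (applyUpTo f N) ≡ a + f a
sum-applyUpTo-step {f} {zero}  (suc N) _         _    zeros =
  trans (cong (f 0 +_) (sum-applyUpTo-zero N λ j → zeros (suc j) (s≤s z≤n))) (+-identityʳ (f 0))
sum-applyUpTo-step {f} {suc a} (suc N) (s≤s a<N) ones zeros = cong₂ _+_ (ones 0 (s≤s z≤n))
  (sum-applyUpTo-step N a<N (λ j j<a → ones (suc j) (s≤s j<a)) (λ j a<j → zeros (suc j) (s≤s a<j)))

sum-applyUpTo-even-odd : ∀ (f : ℕ → ℕ) K →
  sum (applyUpTo f (K + K)) ≡ sum (applyUpTo (λ k → f (k + k)) K) + sum (applyUpTo (λ k → f (suc (k + k))) K)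
sum-applyUpTo-even-odd f zero    = refl
sum-applyUpTo-even-odd f (suc K) = begin
  sum (applyUpTo f (suc K + suc K))              ≡⟨ cong (λ i → sum (applyUpTo f (suc i))) (+-suc K K) ⟩
  f 0 + (f 1 + sum (applyUpTo f″ (K + K)))       ≡⟨ cong (λ s → f 0 + (f 1 + s)) (sum-applyUpTo-even-odd f″ K) ⟩
  f 0 + (f 1 + (evens + odds))                   ≡⟨ cong (f 0 +_) (x∙yz≈y∙xz (f 1) evens odds) ⟩
  f 0 + (evens + (f 1 + odds))                   ≡⟨ +-assoc (f 0) evens _ ⟨
  (f 0 + evens) + (f 1 + odds)                   ≡⟨ cong₂ (λ e o → (f 0 + e) + (f 1 + o))
                                                      (sum-applyUpTo-cong K λ k → cong f (sym (cong suc (+-suc k k))))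
                                                      (sum-applyUpTo-cong K λ k → cong f (sym (cong (suc ∘ suc) (+-suc k k)))) ⟩
  sum (applyUpTo (λ k → f (k + k)) (suc K)) + sum (applyUpTo (λ k → f (suc (k + k))) (suc K)) ∎
  where
  open ≡-Reasoning
  f″ = λ k → f (suc (suc k))
  evens = sum (applyUpTo (λ k → f″ (k + k)) K)
  odds  = sum (applyUpTo (λ k → f″ (suc (k + k))) K)

sum-map-applyUpTo-comm : ∀ {A : Set} (F : A → ℕ → ℕ) N xs →
  sum (map (λ x → sum (applyUpTo (F x) N)) xs) ≡ sum (applyUpTo (λ j → sum (map (λ x → F x j) xs)) N)
sum-map-applyUpTo-comm F N []       = sym (sum-applyUpTo-zero N λ _ → refl)
sum-map-applyUpTo-comm F N (x ∷ xs) = trans (cong (sum (applyUpTo (F x) N) +_) (sum-map-applyUpTo-comm F N xs))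
  (sym (sum-applyUpTo-+ (F x) (λ j → sum (map (λ x → F x j) xs)) N))

data PartsBelow : ℕ → List ℕ → Set where
  []   : ∀ {b} → PartsBelow b []
  cons : ∀ {b x xs} → 1 ≤ x → x ≤ b → PartsBelow x xs → PartsBelow b (x ∷ xs)

IsPartition : ℕ → List ℕ → Set
IsPartition n xs = ∃[ b ] PartsBelow b xs × sum xs ≡ n

PartsBelow-mono : ∀ {a b xs} → a ≤ b → PartsBelow a xs → PartsBelow b xs
PartsBelow-mono a≤b []             = []
PartsBelow-mono a≤b (cons p x≤a q) = cons p (≤-trans x≤a a≤b) q

PartsBelow-sum : ∀ {b xs} → PartsBelow b xs → PartsBelow (sum xs) xs
PartsBelow-sum []                          = []
PartsBelow-sum (cons {x = x} {xs} p _ q) = cons p (m≤m+n x (sum xs)) q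

PartsBelow-0 : ∀ {xs} → PartsBelow 0 xs → xs ≡ []
PartsBelow-0 []            = refl
PartsBelow-0 (cons p q _) with () ← ≤-trans p q

length≤sum : ∀ {b xs} → PartsBelow b xs → length xs ≤ sum xs
length≤sum []             = z≤n
length≤sum (cons p _ q) = +-mono-≤ p (length≤sum q)

partsWithHead : ℕ → ℕ → ℕ → List (List ℕ)
partsWithHead fuel m i =
  if suc i ≤ᵇ suc m then map (suc i ∷_) (partsAux fuel (m ∸ i) (suc i)) else []

∈-partsWithHead⁻ : ∀ {fuel m i xs} → xs ∈ partsWithHead fuel m i →
  i ≤ m × ∃[ ys ] ys ∈ partsAux fuel (m ∸ i) (suc i) × xs ≡ suc i ∷ ys
∈-partsWithHead⁻ {fuel} {m} {i} xs∈ with suc i ≤ᵇ suc m in eq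
... | true = ≤-pred (≤ᵇ⇒≤ (suc i) (suc m) (subst T (sym eq) _)) , ∈-map⁻ (suc i ∷_) xs∈

∈-partsWithHead⁺ : ∀ {fuel m i ys} → i ≤ m → ys ∈ partsAux fuel (m ∸ i) (suc i) →
  (suc i ∷ ys) ∈ partsWithHead fuel m i
∈-partsWithHead⁺ {fuel} {m} {i} i≤m ys∈ with suc i ≤ᵇ suc m | ≤⇒≤ᵇ (s≤s i≤m)
... | true | _ = ∈-map⁺ (suc i ∷_) ys∈

∈-partsAux⁻ : ∀ fuel m b {xs} → xs ∈ partsAux fuel m b → PartsBelow b xs × sum xs ≡ m
∈-partsAux⁻ fuel       zero    b (here refl) = [] , refl
∈-partsAux⁻ (suc fuel) (suc m) b xs∈
  with ys , xs∈ys , ys∈ ← ∈-concat⁻′ (map (partsWithHead fuel m) (upTo b)) xs∈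
  with i , i∈ , refl ← ∈-map⁻ (partsWithHead fuel m) ys∈
  with i≤m , zs , zs∈ , refl ← ∈-partsWithHead⁻ {fuel} {m} {i} xs∈ys
  with zs-parts , zs-sum ← ∈-partsAux⁻ fuel (m ∸ i) (suc i) zs∈ =
  cons (s≤s z≤n) (∈-upTo⁻ i∈) zs-parts , cong suc (trans (cong (i +_) zs-sum) (m+[n∸m]≡n i≤m))

∈-partsAux⁺ : ∀ fuel m b {xs} → m ≤ fuel → PartsBelow b xs → sum xs ≡ m → xs ∈ partsAux fuel m b
∈-partsAux⁺ fuel       zero    b _ []                             _  = here refl
∈-partsAux⁺ fuel       zero    b _ (cons {x = suc _} _ _ _)       ()
∈-partsAux⁺ fuel       (suc m) b _ []                             ()
∈-partsAux⁺ (suc fuel) (suc m) b (s≤s m≤fuel) (cons {x = suc i} {xs} _ x≤b q) eq =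
  ∈-concat⁺′ (∈-partsWithHead⁺ i≤m xs∈) (∈-map⁺ (partsWithHead fuel m) (∈-upTo⁺ x≤b))
  where
  eq′ : i + sum xs ≡ m
  eq′ = suc-injective eq
  i≤m : i ≤ m
  i≤m = subst (i ≤_) eq′ (m≤m+n i (sum xs))
  xs∈ : xs ∈ partsAux fuel (m ∸ i) (suc i)
  xs∈ = ∈-partsAux⁺ fuel (m ∸ i) (suc i) (≤-trans (m∸n≤m m i) m≤fuel) q
          (trans (sym (m+n∸m≡n i (sum xs))) (cong (_∸ i) eq′))

partsAux-unique : ∀ fuel m b → Unique (partsAux fuel m b)
partsAux-unique fuel       zero    b = All.[] AllPairs.∷ AllPairs.[]
partsAux-unique zero       (suc m) b = AllPairs.[]
partsAux-unique (suc fuel) (suc m) b = Unique.concat⁺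
  (All.tabulate λ {xss} xss∈ → with-head-unique xss∈)
  (AllPairsₚ.map⁺ (AllPairs.map disjoint (Unique.upTo⁺ b)))
  where
  with-head-unique : ∀ {xss} → xss ∈ map (partsWithHead fuel m) (upTo b) → Unique xss
  with-head-unique xss∈ with i , _ , refl ← ∈-map⁻ (partsWithHead fuel m) xss∈
    with suc i ≤ᵇ suc m
  ... | true  = Unique.map⁺ (λ where refl → refl) (partsAux-unique fuel (m ∸ i) (suc i))
  ... | false = AllPairs.[]
  head-of : ∀ {i xs} → xs ∈ partsWithHead fuel m i → ∃[ ys ] xs ≡ suc i ∷ ys
  head-of {i} xs∈ with _ , ys , _ , eq ← ∈-partsWithHead⁻ {fuel} {m} {i} xs∈ = ys , eq
  disjoint : ∀ {i j} → i ≢ j → Disjoint (partsWithHead fuel m i) (partsWithHead fuel m j)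
  disjoint {i} {j} i≢j (xs∈i , xs∈j)
    with _ , refl ← head-of {i} xs∈i | _ , eq ← head-of {j} xs∈j =
    i≢j (suc-injective (proj₁ (∷-injective eq)))

∈-partitions⁻ : ∀ {n xs} → xs ∈ partitions n → IsPartition n xs
∈-partitions⁻ {n} xs∈ = n , ∈-partsAux⁻ n n n xs∈

∈-partitions⁺ : ∀ {n xs} → IsPartition n xs → xs ∈ partitions n
∈-partitions⁺ {n} {xs} (_ , parts , refl) = ∈-partsAux⁺ n n n ≤-refl (PartsBelow-sum parts) refl

partitions-unique : ∀ n → Unique (partitions n)
partitions-unique n = partsAux-unique n n n

count-partitions-by-inverses : ∀ {m n} {P Q : Pred (List ℕ) 0ℓ} (P? : Decidable P) (Q? : Decidable Q)
  (f g : List ℕ → List ℕ) →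
  (∀ {xs} → IsPartition m xs → P xs → IsPartition n (f xs) × Q (f xs)) →
  (∀ {ys} → IsPartition n ys → Q ys → IsPartition m (g ys) × P (g ys)) →
  (∀ {xs} → IsPartition m xs → P xs → g (f xs) ≡ xs) →
  (∀ {ys} → IsPartition n ys → Q ys → f (g ys) ≡ ys) →
  length (filter P? (partitions m)) ≡ length (filter Q? (partitions n))
count-partitions-by-inverses {m} {n} P? Q? f g f-maps g-maps gf fg =
  length-≡-by-inverses f g
    (Unique.filter⁺ P? (partitions-unique m)) (Unique.filter⁺ Q? (partitions-unique n))
    (λ xs∈ → let xs∈ , Pxs = ∈-filter⁻ P? xs∈ ; fxs , Qfxs = f-maps (∈-partitions⁻ xs∈) Pxs
             in ∈-filter⁺ Q? (∈-partitions⁺ fxs) Qfxs)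
    (λ ys∈ → let ys∈ , Qys = ∈-filter⁻ Q? ys∈ ; gys , Pgys = g-maps (∈-partitions⁻ ys∈) Qys
             in ∈-filter⁺ P? (∈-partitions⁺ gys) Pgys)
    (λ xs∈ → let xs∈ , Pxs = ∈-filter⁻ P? xs∈ in gf (∈-partitions⁻ xs∈) Pxs)
    (λ ys∈ → let ys∈ , Qys = ∈-filter⁻ Q? ys∈ in fg (∈-partitions⁻ ys∈) Qys)

firstPart : List ℕ → ℕ
firstPart []      = 0
firstPart (x ∷ _) = x

otherParts : List ℕ → List ℕ
otherParts []       = []
otherParts (_ ∷ xs) = xs

removeColumn : List ℕ → List ℕ
removeColumn []                 = []
removeColumn (zero ∷ xs)        = removeColumn xs
removeColumn (suc zero ∷ xs)    = removeColumn xs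
removeColumn (suc (suc x) ∷ xs) = suc x ∷ removeColumn xs

addColumn : ℕ → List ℕ → List ℕ
addColumn zero    _        = []
addColumn (suc k) []       = 1 ∷ addColumn k []
addColumn (suc k) (x ∷ xs) = suc x ∷ addColumn k xs

prependPart : ℕ → List ℕ → List ℕ
prependPart zero    xs = xs
prependPart (suc c) xs = suc c ∷ xs

largest≡firstPart : ∀ {b xs} → PartsBelow b xs → largest xs ≡ firstPart xs
largest≡firstPart []                                  = refl
largest≡firstPart (cons {x = x} _ _ [])               = ⊔-identityʳ x
largest≡firstPart (cons {x = x} _ _ q@(cons _ y≤x _)) =
  trans (cong (x ⊔_) (largest≡firstPart q)) (m≥n⇒m⊔n≡m y≤x)

firstPart≤ : ∀ {b xs} → PartsBelow b xs → firstPart xs ≤ b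
firstPart≤ []             = z≤n
firstPart≤ (cons _ x≤b _) = x≤b

PartsBelow-firstPart : ∀ {b xs} → PartsBelow b xs → PartsBelow (firstPart xs) xs
PartsBelow-firstPart []           = []
PartsBelow-firstPart (cons p _ q) = cons p ≤-refl q

PartsBelow-otherParts : ∀ {b xs} → PartsBelow b xs → PartsBelow (firstPart xs) (otherParts xs)
PartsBelow-otherParts []           = []
PartsBelow-otherParts (cons _ _ q) = q

length-otherParts : ∀ xs → pred (length xs) ≡ length (otherParts xs)
length-otherParts []      = refl
length-otherParts (_ ∷ _) = refl

sum-firstPart-otherParts : ∀ xs → firstPart xs + sum (otherParts xs) ≡ sum xs
sum-firstPart-otherParts []       = refl
sum-firstPart-otherParts (_ ∷ _) = refl

PartsBelow-removeColumn : ∀ {b xs} → PartsBelow b xs → PartsBelow (pred b) (removeColumn xs)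
PartsBelow-removeColumn []                                  = []
PartsBelow-removeColumn (cons {x = suc zero}    _ _   q) = PartsBelow-mono z≤n (PartsBelow-removeColumn q)
PartsBelow-removeColumn (cons {x = suc (suc x)} _ x≤b q) =
  cons (s≤s z≤n) (pred-mono-≤ x≤b) (PartsBelow-removeColumn q)

sum-removeColumn : ∀ {b xs} → PartsBelow b xs → sum (removeColumn xs) + length xs ≡ sum xs
sum-removeColumn []                                       = refl
sum-removeColumn (cons {x = suc zero}    {xs} _ _ q) =
  trans (+-suc (sum (removeColumn xs)) (length xs)) (cong suc (sum-removeColumn q))
sum-removeColumn (cons {x = suc (suc x)} {xs} _ _ q) = cong suc (begin
  (x + sum (removeColumn xs)) + suc (length xs) ≡⟨ +-assoc x _ _ ⟩
  x + (sum (removeColumn xs) + suc (length xs)) ≡⟨ cong (x +_) (+-suc _ _) ⟩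
  x + suc (sum (removeColumn xs) + length xs)   ≡⟨ cong (λ s → x + suc s) (sum-removeColumn q) ⟩
  x + suc (sum xs)                              ≡⟨ +-suc x (sum xs) ⟩
  suc x + sum xs                                ∎)
  where open ≡-Reasoning

length-removeColumn : ∀ xs → length (removeColumn xs) ≤ length xs
length-removeColumn []                 = z≤n
length-removeColumn (zero ∷ xs)        = m≤n⇒m≤1+n (length-removeColumn xs)
length-removeColumn (suc zero ∷ xs)    = m≤n⇒m≤1+n (length-removeColumn xs)
length-removeColumn (suc (suc _) ∷ xs) = s≤s (length-removeColumn xs)

removeColumn-addColumn : ∀ {b xs} k → PartsBelow b xs → length xs ≤ k → removeColumn (addColumn k xs) ≡ xs
removeColumn-addColumn zero    []            _         = refl
removeColumn-addColumn (suc k) []            _         = removeColumn-addColumn {0} k [] z≤n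
removeColumn-addColumn (suc k) (cons {x = suc x} _ _ q) (s≤s ℓ≤k) = cong (suc x ∷_) (removeColumn-addColumn k q ℓ≤k)

addColumn-removeColumn : ∀ {b xs} → PartsBelow b xs → addColumn (length xs) (removeColumn xs) ≡ xs
addColumn-removeColumn [] = refl
addColumn-removeColumn (cons {x = suc zero} {xs} _ _ q) = begin
  addColumn (suc (length xs)) (removeColumn xs) ≡⟨ cong (addColumn (suc (length xs))) no-column ⟩
  1 ∷ addColumn (length xs) []                  ≡⟨ cong (λ ys → 1 ∷ addColumn (length xs) ys) no-column ⟨
  1 ∷ addColumn (length xs) (removeColumn xs)   ≡⟨ cong (1 ∷_) (addColumn-removeColumn q) ⟩
  1 ∷ xs                                        ∎
  where
  open ≡-Reasoning
  no-column : removeColumn xs ≡ []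
  no-column = PartsBelow-0 (PartsBelow-removeColumn q)
addColumn-removeColumn (cons {x = suc (suc x)} _ _ q) = cong (suc (suc x) ∷_) (addColumn-removeColumn q)

length-addColumn : ∀ k xs → length (addColumn k xs) ≡ k
length-addColumn zero    _        = refl
length-addColumn (suc k) []       = cong suc (length-addColumn k [])
length-addColumn (suc k) (_ ∷ xs) = cong suc (length-addColumn k xs)

sum-addColumn : ∀ k xs → length xs ≤ k → sum (addColumn k xs) ≡ k + sum xs
sum-addColumn zero    []       _         = refl
sum-addColumn (suc k) []       _         = cong suc (sum-addColumn k [] z≤n)
sum-addColumn (suc k) (x ∷ xs) (s≤s ℓ≤k) = cong suc (begin
  x + sum (addColumn k xs) ≡⟨ cong (x +_) (sum-addColumn k xs ℓ≤k) ⟩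
  x + (k + sum xs)         ≡⟨ x∙yz≈y∙xz x k (sum xs) ⟩
  k + (x + sum xs)         ∎)
  where open ≡-Reasoning

PartsBelow-addColumn : ∀ {b xs} k → PartsBelow b xs → length xs ≤ k → PartsBelow (suc b) (addColumn k xs)
PartsBelow-addColumn zero    _                _         = []
PartsBelow-addColumn (suc k) []               _         = cons (s≤s z≤n) (s≤s z≤n) (PartsBelow-addColumn {0} k [] z≤n)
PartsBelow-addColumn (suc k) (cons _ x≤b q) (s≤s ℓ≤k) = cons (s≤s z≤n) (s≤s x≤b) (PartsBelow-addColumn k q ℓ≤k)

firstPart-addColumn : ∀ k xs → firstPart (addColumn (suc k) xs) ≡ suc (firstPart xs)
firstPart-addColumn k []      = refl
firstPart-addColumn k (_ ∷ _) = refl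

PartsBelow-prependPart : ∀ {c xs} → PartsBelow c xs → PartsBelow c (prependPart c xs)
PartsBelow-prependPart {zero}  q = q
PartsBelow-prependPart {suc c} q = cons (s≤s z≤n) ≤-refl q

sum-prependPart : ∀ c xs → sum (prependPart c xs) ≡ c + sum xs
sum-prependPart zero    _ = refl
sum-prependPart (suc c) _ = refl

length-prependPart : ∀ c xs → length (prependPart c xs) ≤ suc (length xs)
length-prependPart zero    xs = n≤1+n (length xs)
length-prependPart (suc c) xs = ≤-refl

firstPart-prependPart : ∀ {c xs} → PartsBelow c xs → firstPart (prependPart c xs) ≡ c
firstPart-prependPart {zero}  q rewrite PartsBelow-0 q = refl
firstPart-prependPart {suc c} q = refl

otherParts-prependPart : ∀ {c xs} → PartsBelow c xs → otherParts (prependPart c xs) ≡ xs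
otherParts-prependPart {zero}  q rewrite PartsBelow-0 q = refl
otherParts-prependPart {suc c} q = refl

prependPart-firstPart : ∀ {b xs} → PartsBelow b xs → prependPart (firstPart xs) (otherParts xs) ≡ xs
prependPart-firstPart []                      = refl
prependPart-firstPart (cons {x = suc _} _ _ _) = refl

RankAtMostNeg : ℕ → Pred (List ℕ) 0ℓ
RankAtMostNeg m xs = largest xs + m ≤ length xs

rankAtMostNeg? : ∀ m → Decidable (RankAtMostNeg m)
rankAtMostNeg? m xs = largest xs + m ≤? length xs

rankShift : ℕ → List ℕ → List ℕ
rankShift m xs = prependPart (length xs ∸ suc m) (removeColumn xs)

rankUnshift : ℕ → List ℕ → List ℕ
rankUnshift m ys = addColumn (suc (firstPart ys + m)) (otherParts ys)

1≤firstPart : ∀ {b xs n} → PartsBelow b xs → sum xs ≡ suc n → 1 ≤ firstPart xs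
1≤firstPart (cons p _ _) _ = p

module RankShift {m n xs} (xs-part : IsPartition (suc m + n) xs) (rank : RankAtMostNeg m xs) where
  parts = proj₁ (proj₂ xs-part)
  c = length xs ∸ suc m
  d = removeColumn xs

  rank′ : firstPart xs + m ≤ length xs
  rank′ = subst (λ h → h + m ≤ length xs) (largest≡firstPart parts) rank

  c+1+m≡length : c + suc m ≡ length xs
  c+1+m≡length = m∸n+n≡m (≤-trans (+-monoˡ-≤ m (1≤firstPart parts (proj₂ (proj₂ xs-part)))) rank′)

  d-parts : PartsBelow c d
  d-parts = PartsBelow-mono (pred-mono-≤ first≤1+c) (PartsBelow-removeColumn (PartsBelow-firstPart parts))
    where
    first≤1+c : firstPart xs ≤ suc c
    first≤1+c = +-cancelʳ-≤ m _ _ (subst (firstPart xs + m ≤_) (trans (sym c+1+m≡length) (+-suc c m)) rank′)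

rankShift-maps : ∀ {m n xs} → IsPartition (suc m + n) xs → RankAtMostNeg m xs →
  IsPartition n (rankShift m xs) × ¬ RankAtMostNeg (m + 3) (rankShift m xs)
rankShift-maps {m} {n} {xs} xs-part rank =
  (c , PartsBelow-prependPart d-parts , sum-rankShift) , <⇒≱ length<largest+m+3
  where
  open RankShift xs-part rank
  sum-rankShift : sum (prependPart c d) ≡ n
  sum-rankShift = trans (sum-prependPart c d) (+-cancelʳ-≡ (suc m) _ _ (begin
    (c + sum d) + suc m      ≡⟨ shuffle c m (sum d) ⟩
    sum d + (c + suc m)      ≡⟨ cong (sum d +_) c+1+m≡length ⟩
    sum d + length xs        ≡⟨ sum-removeColumn parts ⟩
    sum xs                   ≡⟨ proj₂ (proj₂ xs-part) ⟩
    suc m + n                ≡⟨ +-comm (suc m) n ⟩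
    n + suc m                ∎))
    where
    open ≡-Reasoning
    shuffle : ∀ a b s → (a + s) + suc b ≡ s + (a + suc b)
    shuffle = solve-∀
  length<largest+m+3 : length (prependPart c d) < largest (prependPart c d) + (m + 3)
  length<largest+m+3 = begin-strict
    length (prependPart c d) ≤⟨ length-prependPart c d ⟩
    suc (length d)           ≤⟨ s≤s (length-removeColumn xs) ⟩
    suc (length xs)          ≡⟨ cong suc c+1+m≡length ⟨
    suc (c + suc m)          <⟨ n<1+n _ ⟩
    suc (suc (c + suc m))    ≡⟨ rearrange c m ⟩
    c + (m + 3)              ≡⟨ cong (_+ (m + 3)) (trans (largest≡firstPart (PartsBelow-prependPart d-parts))
                                                        (firstPart-prependPart d-parts)) ⟨
    largest (prependPart c d) + (m + 3) ∎
    where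
    open ≤-Reasoning
    rearrange : ∀ a b → suc (suc (a + suc b)) ≡ a + (b + 3)
    rearrange = solve-∀

rankUnshift-rankShift : ∀ {m n xs} → IsPartition (suc m + n) xs → RankAtMostNeg m xs →
  rankUnshift m (rankShift m xs) ≡ xs
rankUnshift-rankShift {m} {n} {xs} xs-part rank = begin
  addColumn (suc (firstPart (prependPart c d) + m)) (otherParts (prependPart c d))
    ≡⟨ cong₂ (λ h ys → addColumn (suc (h + m)) ys) (firstPart-prependPart d-parts) (otherParts-prependPart d-parts) ⟩
  addColumn (suc (c + m)) d
    ≡⟨ cong (λ k → addColumn k d) (trans (sym (+-suc c m)) c+1+m≡length) ⟩
  addColumn (length xs) d
    ≡⟨ addColumn-removeColumn parts ⟩
  xs ∎
  where
  open ≡-Reasoning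
  open RankShift xs-part rank

module RankUnshift {m n ys} (ys-part : IsPartition n ys) (rank : ¬ RankAtMostNeg (m + 3) ys) where
  parts = proj₁ (proj₂ ys-part)
  k = suc (firstPart ys + m)

  tail-parts : PartsBelow (firstPart ys) (otherParts ys)
  tail-parts = PartsBelow-otherParts parts

  length-tail≤k : length (otherParts ys) ≤ k
  length-tail≤k = subst (_≤ k) (length-otherParts ys) (pred-mono-≤ (≤-pred length<k+2))
    where
    reassoc : ∀ a b → a + (b + 3) ≡ suc (suc (suc (a + b)))
    reassoc = solve-∀
    length<k+2 : length ys < suc (suc k)
    length<k+2 = subst (length ys <_) (reassoc (firstPart ys) m)
      (subst (λ h → length ys < h + (m + 3)) (largest≡firstPart parts) (≰⇒> rank))

rankUnshift-maps : ∀ {m n ys} → IsPartition n ys → ¬ RankAtMostNeg (m + 3) ys →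
  IsPartition (suc m + n) (rankUnshift m ys) × RankAtMostNeg m (rankUnshift m ys)
rankUnshift-maps {m} {n} {ys} ys-part rank = (suc (firstPart ys) , image-parts , sum-rankUnshift) , rank-image
  where
  open RankUnshift ys-part rank
  image-parts = PartsBelow-addColumn k tail-parts length-tail≤k
  sum-rankUnshift : sum (rankUnshift m ys) ≡ suc m + n
  sum-rankUnshift = begin
    sum (addColumn k (otherParts ys))           ≡⟨ sum-addColumn k (otherParts ys) length-tail≤k ⟩
    suc (firstPart ys + m) + sum (otherParts ys) ≡⟨ shuffle (firstPart ys) m (sum (otherParts ys)) ⟩
    suc m + (firstPart ys + sum (otherParts ys)) ≡⟨ cong (suc m +_) (sum-firstPart-otherParts ys) ⟩
    suc m + sum ys                               ≡⟨ cong (suc m +_) (proj₂ (proj₂ ys-part)) ⟩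
    suc m + n                                    ∎
    where
    open ≡-Reasoning
    shuffle : ∀ h b s → suc (h + b) + s ≡ suc b + (h + s)
    shuffle = solve-∀
  rank-image : RankAtMostNeg m (rankUnshift m ys)
  rank-image = subst₂ (λ h ℓ → h + m ≤ ℓ)
    (sym (trans (largest≡firstPart image-parts) (firstPart-addColumn (firstPart ys + m) (otherParts ys))))
    (sym (length-addColumn k (otherParts ys)))
    (s≤s (+-monoˡ-≤ m (firstPart≤ tail-parts)))

rankShift-rankUnshift : ∀ {m n ys} → IsPartition n ys → ¬ RankAtMostNeg (m + 3) ys →
  rankShift m (rankUnshift m ys) ≡ ys
rankShift-rankUnshift {m} {n} {ys} ys-part rank = begin
  prependPart (length (addColumn k (otherParts ys)) ∸ suc m) (removeColumn (addColumn k (otherParts ys)))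
    ≡⟨ cong₂ prependPart (trans (cong (_∸ suc m) (length-addColumn k (otherParts ys))) (m+n∸n≡m (firstPart ys) m))
                         (removeColumn-addColumn k tail-parts length-tail≤k) ⟩
  prependPart (firstPart ys) (otherParts ys)
    ≡⟨ prependPart-firstPart parts ⟩
  ys ∎
  where
  open ≡-Reasoning
  open RankUnshift ys-part rank

rankAtMostNegCount : ℕ → ℕ → ℕ
rankAtMostNegCount m n = length (filter (rankAtMostNeg? m) (partitions n))

rank-recurrence : ∀ m n → rankAtMostNegCount m (suc m + n) + rankAtMostNegCount (m + 3) n ≡ length (partitions n)
rank-recurrence m n = begin
  rankAtMostNegCount m (suc m + n) + rankAtMostNegCount (m + 3) n
    ≡⟨ cong (_+ rankAtMostNegCount (m + 3) n) shift ⟩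
  length (filter ¬low? (partitions n)) + rankAtMostNegCount (m + 3) n
    ≡⟨ +-comm _ (rankAtMostNegCount (m + 3) n) ⟩
  rankAtMostNegCount (m + 3) n + length (filter ¬low? (partitions n))
    ≡⟨ length-filter-∁ (rankAtMostNeg? (m + 3)) (partitions n) ⟩
  length (partitions n) ∎
  where
  open ≡-Reasoning
  ¬low? = ∁? (rankAtMostNeg? (m + 3))
  shift : rankAtMostNegCount m (suc m + n) ≡ length (filter ¬low? (partitions n))
  shift = count-partitions-by-inverses (rankAtMostNeg? m) ¬low? (rankShift m) (rankUnshift m)
    rankShift-maps rankUnshift-maps rankUnshift-rankShift rankShift-rankUnshift

p⊖ : ℕ → ℕ → ℕ
p⊖ n       zero    = length (partitions n)
p⊖ zero    (suc s) = 0
p⊖ (suc n) (suc s) = p⊖ n s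

p⊖-+ : ∀ c n s → p⊖ (c + n) (c + s) ≡ p⊖ n s
p⊖-+ zero    n s = refl
p⊖-+ (suc c) n s = p⊖-+ c n s

p⊖-< : ∀ {n s} → n < s → p⊖ n s ≡ 0
p⊖-< {zero}  {suc s} _         = refl
p⊖-< {suc n} {suc s} (s≤s n<s) = p⊖-< n<s

p-⊖ : ∀ n s → p (ℤ.+ n ℤ.- ℤ.+ s) ≡ p⊖ n s
p-⊖ n s = trans (cong p (ℤ.m-n≡m⊖n n s)) (go n s)
  where
  go : ∀ n s → p (n ℤ.⊖ s) ≡ p⊖ n s
  go n       zero    = refl
  go zero    (suc s) = refl
  go (suc n) (suc s) = trans (cong p (ℤ.[1+m]⊖[1+n]≡m⊖n n s)) (go n s)

pentagonal : ℕ → ℕ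
pentagonal zero    = 0
pentagonal (suc j) = pentagonal j + suc (suc (3 * j))

pentagonal-+ : ∀ a s → pentagonal a + s ≤ pentagonal (a + s)
pentagonal-+ a zero    = ≤-reflexive (trans (+-identityʳ _) (cong pentagonal (sym (+-identityʳ a))))
pentagonal-+ a (suc s) = begin
  pentagonal a + suc s                          ≡⟨ +-suc (pentagonal a) s ⟩
  suc (pentagonal a + s)                        ≤⟨ s≤s (pentagonal-+ a s) ⟩
  suc (pentagonal (a + s))                      ≤⟨ m<m+n (pentagonal (a + s)) (s≤s z≤n) ⟩
  pentagonal (a + s) + suc (suc (3 * (a + s)))  ≡⟨ cong pentagonal (+-suc a s) ⟨
  pentagonal (a + suc s)                        ∎
  where open ≤-Reasoning

2*pentagonal : ∀ j → 2 * pentagonal j ≡ j * (3 * j + 1)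
2*pentagonal zero    = refl
2*pentagonal (suc j) = begin
  2 * (pentagonal j + suc (suc (3 * j)))        ≡⟨ *-distribˡ-+ 2 (pentagonal j) _ ⟩
  2 * pentagonal j + 2 * suc (suc (3 * j))      ≡⟨ cong (_+ 2 * suc (suc (3 * j))) (2*pentagonal j) ⟩
  j * (3 * j + 1) + 2 * suc (suc (3 * j))       ≡⟨ step j ⟩
  suc j * (3 * suc j + 1)                       ∎
  where
  open ≡-Reasoning
  step : ∀ j → j * (3 * j + 1) + 2 * suc (suc (3 * j)) ≡ suc j * (3 * suc j + 1)
  step = solve-∀

pentagonal-even : ∀ k → pentagonal (k + k) ≡ k * (6 * k + 1)
pentagonal-even k = *-cancelˡ-≡ _ _ 2 (trans (2*pentagonal (k + k)) (step k))
  where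
  step : ∀ k → (k + k) * (3 * (k + k) + 1) ≡ 2 * (k * (6 * k + 1))
  step = solve-∀

pentagonal-odd : ∀ k → pentagonal (suc (k + k)) ≡ (2 * k + 1) * (3 * k + 2)
pentagonal-odd k = *-cancelˡ-≡ _ _ 2 (trans (2*pentagonal (suc (k + k))) (step k))
  where
  step : ∀ k → suc (k + k) * (3 * suc (k + k) + 1) ≡ 2 * ((2 * k + 1) * (3 * k + 2))
  step = solve-∀

rankAtMostNegCount-small : ∀ {m n} → 1 ≤ m → n ≤ m → rankAtMostNegCount m n ≡ 0
rankAtMostNegCount-small {m} {n} 1≤m n≤m =
  cong length (filter-none (rankAtMostNeg? m) (All.tabulate λ xs∈ → <⇒≱ (too-long (∈-partitions⁻ xs∈))))
  where
  too-long : ∀ {xs} → IsPartition n xs → length xs < largest xs + m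
  too-long {[]}    _                           = 1≤m
  too-long {_ ∷ _} (_ , parts@(cons p _ _) , refl) rewrite largest≡firstPart parts =
    ≤-trans (s≤s (≤-trans (length≤sum parts) n≤m)) (+-monoˡ-≤ m p)

term : ℕ → ℕ → ℕ → ℕ
term j n i = p⊖ (n + pentagonal j) (pentagonal (j + i))

oddTerms evenTerms : ℕ → ℕ → ℕ → ℕ
oddTerms  N j n = sum (applyUpTo (λ k → term j n (suc (k + k))) N)
evenTerms N j n = sum (applyUpTo (λ k → term j n (suc (suc (k + k)))) N)

term-shift : ∀ j n i → term j (suc (suc (3 * j)) + n) (suc i) ≡ term (suc j) n i
term-shift j n i = cong₂ p⊖ (shuffle j n (pentagonal j)) (cong pentagonal (+-suc j i))
  where
  shuffle : ∀ j n p → (suc (suc (3 * j)) + n) + p ≡ n + (p + suc (suc (3 * j)))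
  shuffle = solve-∀

term-first : ∀ j n → term j n 0 ≡ length (partitions n)
term-first j n = trans (cong₂ p⊖ (+-comm n (pentagonal j)) (cong pentagonal (+-identityʳ j)))
  (trans (cong (p⊖ (pentagonal j + n)) (sym (+-identityʳ (pentagonal j)))) (p⊖-+ (pentagonal j) n 0))

term-beyond : ∀ j n i → n < suc (suc (3 * j)) + i → term j n (suc i) ≡ 0
term-beyond j n i n<3j+2+i = p⊖-< (begin-strict
  n + pentagonal j                          <⟨ +-monoˡ-< (pentagonal j) n<3j+2+i ⟩
  (suc (suc (3 * j)) + i) + pentagonal j    ≡⟨ shuffle j i (pentagonal j) ⟩
  pentagonal (suc j) + i                    ≤⟨ pentagonal-+ (suc j) i ⟩
  pentagonal (suc j + i)                    ≡⟨ cong pentagonal (+-suc j i) ⟨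
  pentagonal (j + suc i)                    ∎)
  where
  open ≤-Reasoning
  shuffle : ∀ j i p → (suc (suc (3 * j)) + i) + p ≡ (p + suc (suc (3 * j))) + i
  shuffle = solve-∀

oddTerms-shift : ∀ N j n →
  oddTerms (suc N) j (suc (suc (3 * j)) + n) ≡ length (partitions n) + evenTerms N (suc j) n
oddTerms-shift N j n = cong₂ _+_ (trans (term-shift j n 0) (term-first (suc j) n))
  (sum-applyUpTo-cong N λ k → trans (cong (term j _) (cong suc (+-suc (suc k) k))) (term-shift j n (suc (suc (k + k)))))

evenTerms-shift : ∀ N j n → n ≤ N →
  evenTerms (suc N) j (suc (suc (3 * j)) + n) ≡ oddTerms N (suc j) n
evenTerms-shift N j n n≤N = begin
  evenTerms (suc N) j (suc (suc (3 * j)) + n)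
    ≡⟨ sum-applyUpTo-cong (suc N) (λ k → term-shift j n (suc (k + k))) ⟩
  oddTerms (suc N) (suc j) n
    ≡⟨ sum-applyUpTo-suc (λ k → term (suc j) n (suc (k + k))) N ⟩
  oddTerms N (suc j) n + term (suc j) n (suc (N + N))
    ≡⟨ cong (oddTerms N (suc j) n +_) (term-beyond (suc j) n (N + N) n<) ⟩
  oddTerms N (suc j) n + 0
    ≡⟨ +-identityʳ _ ⟩
  oddTerms N (suc j) n ∎
  where
  open ≡-Reasoning
  n< : n < suc (suc (3 * suc j)) + (N + N)
  n< = s≤s (≤-trans (≤-trans n≤N (m≤m+n N N)) (m≤n+m (N + N) (suc (3 * suc j))))

alternating-rank-sum : ∀ N j n → n ≤ N →
  rankAtMostNegCount (suc (3 * j)) n + evenTerms N j n ≡ oddTerms N j n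
alternating-rank-sum N j n n≤N with n <? suc (suc (3 * j))
... | yes small = trans
  (cong₂ _+_ (rankAtMostNegCount-small (s≤s z≤n) (≤-pred small))
             (sum-applyUpTo-zero N λ k → term-beyond j n (suc (k + k)) (≤-trans small (m≤m+n _ _))))
  (sym (sum-applyUpTo-zero N λ k → term-beyond j n (k + k) (≤-trans small (m≤m+n _ _))))
... | no large with n′ , refl ← m≤n⇒∃[o]m+o≡n (≮⇒≥ large) with N | n≤N
...   | suc N | s≤s n≤N = begin
  rankAtMostNegCount m n + evenTerms (suc N) j n
    ≡⟨ cong (rankAtMostNegCount m n +_) (evenTerms-shift N j n′ n′≤N) ⟩
  rankAtMostNegCount m n + oddTerms N (suc j) n′
    ≡⟨ cong (rankAtMostNegCount m n +_) (alternating-rank-sum N (suc j) n′ n′≤N) ⟨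
  rankAtMostNegCount m n + (rankAtMostNegCount (suc (3 * suc j)) n′ + evenTerms N (suc j) n′)
    ≡⟨ +-assoc (rankAtMostNegCount m n) _ _ ⟨
  (rankAtMostNegCount m n + rankAtMostNegCount (suc (3 * suc j)) n′) + evenTerms N (suc j) n′
    ≡⟨ cong (λ m′ → (rankAtMostNegCount m n + rankAtMostNegCount m′ n′) + evenTerms N (suc j) n′) (m+3≡ j) ⟨
  (rankAtMostNegCount m n + rankAtMostNegCount (m + 3) n′) + evenTerms N (suc j) n′
    ≡⟨ cong (_+ evenTerms N (suc j) n′) (rank-recurrence m n′) ⟩
  length (partitions n′) + evenTerms N (suc j) n′
    ≡⟨ oddTerms-shift N j n′ ⟨
  oddTerms (suc N) j n ∎
  where
  open ≡-Reasoning
  m = suc (3 * j)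
  n′≤N : n′ ≤ N
  n′≤N = ≤-trans (m≤n+m n′ (suc (3 * j))) n≤N
  m+3≡ : ∀ j → suc (3 * j) + 3 ≡ suc (3 * suc j)
  m+3≡ = solve-∀

evenPentagonalSum oddPentagonalSum : ℕ → ℕ
evenPentagonalSum n = sum (applyUpTo (λ k → p⊖ n (pentagonal (k + k))) (suc n))
oddPentagonalSum  n = sum (applyUpTo (λ k → p⊖ n (pentagonal (suc (k + k)))) (suc n))

R+rankAtMostNegCount : ∀ n → R n + rankAtMostNegCount 1 n ≡ length (partitions n)
R+rankAtMostNegCount n = begin
  R n + rankAtMostNegCount 1 n
    ≡⟨ +-comm (R n) _ ⟩
  rankAtMostNegCount 1 n + R n
    ≡⟨ cong (λ r → rankAtMostNegCount 1 n + length r) (filter-≐ _ _ nonneg⇔ (partitions n)) ⟩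
  rankAtMostNegCount 1 n + length (filter (∁? (rankAtMostNeg? 1)) (partitions n))
    ≡⟨ length-filter-∁ (rankAtMostNeg? 1) (partitions n) ⟩
  length (partitions n) ∎
  where
  open ≡-Reasoning
  nonneg⇔ : (λ xs → length xs ≤ largest xs) ≐ ∁ (RankAtMostNeg 1)
  nonneg⇔ = (λ {xs} ℓ≤ low → <⇒≱ (subst (_≤ length xs) (+-comm (largest xs) 1) low) ℓ≤)
          , (λ {xs} ¬low → ≤-pred (subst (length xs <_) (+-comm (largest xs) 1) (≰⇒> ¬low)))

R+odd≡even : ∀ n → R n + oddPentagonalSum n ≡ evenPentagonalSum n
R+odd≡even n = begin
  R n + oddPentagonalSum n                                ≡⟨ cong (R n +_) odd≡ ⟨
  R n + oddTerms (suc n) 0 n                              ≡⟨ cong (R n +_) (alternating-rank-sum (suc n) 0 n (n≤1+n n)) ⟨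
  R n + (rankAtMostNegCount 1 n + evenTerms (suc n) 0 n)  ≡⟨ +-assoc (R n) _ _ ⟨
  (R n + rankAtMostNegCount 1 n) + evenTerms (suc n) 0 n  ≡⟨ cong₂ _+_ (R+rankAtMostNegCount n) even≡ ⟩
  evenPentagonalSum n                                     ∎
  where
  open ≡-Reasoning
  n+0 = +-identityʳ n
  odd≡ : oddTerms (suc n) 0 n ≡ oddPentagonalSum n
  odd≡ = sum-applyUpTo-cong (suc n) λ k → cong (λ t → p⊖ t (pentagonal (suc (k + k)))) n+0
  even≡ : evenTerms (suc n) 0 n ≡ sum (applyUpTo (λ k → p⊖ n (pentagonal (suc k + suc k))) n)
  even≡ = begin
    evenTerms (suc n) 0 n                           ≡⟨ sum-applyUpTo-suc _ n ⟩
    evenTerms n 0 n + term 0 n (suc (suc (n + n)))  ≡⟨ cong (evenTerms n 0 n +_) (term-beyond 0 n (suc (n + n)) n<) ⟩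
    evenTerms n 0 n + 0                             ≡⟨ +-identityʳ _ ⟩
    evenTerms n 0 n
      ≡⟨ sum-applyUpTo-cong n (λ k → cong₂ p⊖ n+0 (cong pentagonal (sym (cong suc (+-suc k k))))) ⟩
    sum (applyUpTo (λ k → p⊖ n (pentagonal (suc k + suc k))) n) ∎
    where
    n< : n < 2 + suc (n + n)
    n< = s≤s (≤-trans (m≤m+n n n) (≤-trans (n≤1+n _) (n≤1+n _)))

removePart : ℕ → List ℕ → List ℕ
removePart x []       = []
removePart x (y ∷ ys) with y ≟ x
... | yes _ = ys
... | no  _ = y ∷ removePart x ys

insertPart : ℕ → List ℕ → List ℕ
insertPart x []       = x ∷ []
insertPart x (y ∷ ys) with y ≤? x
... | yes _ = x ∷ y ∷ ys
... | no  _ = y ∷ insertPart x ys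

infix 4 _⊆ₘ_ _⊆ₘ?_

data _⊆ₘ_ : List ℕ → List ℕ → Set where
  []  : ∀ {l} → [] ⊆ₘ l
  _∷_ : ∀ {x M l} → x ∈ l → M ⊆ₘ removePart x l → x ∷ M ⊆ₘ l

_⊆ₘ?_ : ∀ M l → Dec (M ⊆ₘ l)
[]      ⊆ₘ? l = yes []
(x ∷ M) ⊆ₘ? l =
  map′ (λ (x∈ , M⊆) → x∈ ∷ M⊆) (λ where (x∈ ∷ M⊆) → x∈ , M⊆) (x ∈? l ×-dec M ⊆ₘ? removePart x l)

PartsBelow-removePart : ∀ {b l} x → PartsBelow b l → PartsBelow b (removePart x l)
PartsBelow-removePart x [] = []
PartsBelow-removePart x (cons {x = y} p y≤b q) with y ≟ x
... | yes _ = PartsBelow-mono y≤b q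
... | no  _ = cons p y≤b (PartsBelow-removePart x q)

sum-removePart : ∀ {x l} → x ∈ l → x + sum (removePart x l) ≡ sum l
sum-removePart {x} {y ∷ ys} x∈ with y ≟ x | x∈
... | yes refl | _         = refl
... | no  y≢x  | here refl = ⊥-elim (y≢x refl)
... | no  _    | there x∈ys = trans (x∙yz≈y∙xz x y _) (cong (y +_) (sum-removePart x∈ys))

∈⇒≤ : ∀ {b l x} → PartsBelow b l → x ∈ l → x ≤ b
∈⇒≤ (cons _ x≤b _)  (here refl) = x≤b
∈⇒≤ (cons _ y≤b q) (there x∈)   = ≤-trans (∈⇒≤ q x∈) y≤b

∈-insertPart : ∀ x l → x ∈ insertPart x l
∈-insertPart x []       = here refl
∈-insertPart x (y ∷ ys) with y ≤? x
... | yes _ = here refl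
... | no  _ = there (∈-insertPart x ys)

removePart-insertPart : ∀ x l → removePart x (insertPart x l) ≡ l
removePart-insertPart x []       with x ≟ x
... | yes _   = refl
... | no  x≢x = ⊥-elim (x≢x refl)
removePart-insertPart x (y ∷ ys) with y ≤? x
... | yes _ with x ≟ x
...   | yes _   = refl
...   | no  x≢x = ⊥-elim (x≢x refl)
removePart-insertPart x (y ∷ ys) | no y≰x with y ≟ x
...   | yes refl = ⊥-elim (y≰x ≤-refl)
...   | no  _    = cong (y ∷_) (removePart-insertPart x ys)

insertPart-removePart : ∀ {b l x} → PartsBelow b l → x ∈ l → insertPart x (removePart x l) ≡ l
insertPart-removePart {x = x} (cons {x = y} {ys} _ _ q) x∈ with y ≟ x | x∈
... | yes refl | _          = insert-head q
  where
  insert-head : ∀ {zs} → PartsBelow x zs → insertPart x zs ≡ x ∷ zs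
  insert-head []                      = refl
  insert-head (cons {x = z} _ z≤x _) with z ≤? x
  ... | yes _   = refl
  ... | no  z≰x = ⊥-elim (z≰x z≤x)
... | no  y≢x  | here refl  = ⊥-elim (y≢x refl)
... | no  y≢x  | there x∈ys with y ≤? x
...   | yes y≤x = ⊥-elim (y≢x (≤-antisym y≤x (∈⇒≤ q x∈ys)))
...   | no  _   = cong (y ∷_) (insertPart-removePart q x∈ys)

PartsBelow-insertPart : ∀ {b l x} → PartsBelow b l → 1 ≤ x → x ≤ b → PartsBelow b (insertPart x l)
PartsBelow-insertPart [] 1≤x x≤b = cons 1≤x x≤b []
PartsBelow-insertPart {x = x} (cons {x = y} 1≤y y≤b q) 1≤x x≤b with y ≤? x
... | yes y≤x = cons 1≤x x≤b (cons 1≤y y≤x q)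
... | no  y≰x = cons 1≤y y≤b (PartsBelow-insertPart q 1≤x (<⇒≤ (≰⇒> y≰x)))

sum-insertPart : ∀ x l → sum (insertPart x l) ≡ x + sum l
sum-insertPart x []       = refl
sum-insertPart x (y ∷ ys) with y ≤? x
... | yes _ = refl
... | no  _ = trans (cong (y +_) (sum-insertPart x ys)) (x∙yz≈y∙xz y x (sum ys))

count-⊆ₘ : ∀ M → All (1 ≤_) M → ∀ n → length (filter (M ⊆ₘ?_) (partitions n)) ≡ p⊖ n (sum M)
count-⊆ₘ []      _            n = cong length (filter-all ([] ⊆ₘ?_) {partitions n} (All.tabulate λ _ → []))
count-⊆ₘ (x ∷ M) (1≤x All.∷ M⁺) n with x ≤? n
... | no x≰n = trans (cong length (filter-none (x ∷ M ⊆ₘ?_) (All.tabulate λ l∈ → too-big (∈-partitions⁻ l∈))))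
                     (sym (p⊖-< (≤-trans (≰⇒> x≰n) (m≤m+n x (sum M)))))
  where
  too-big : ∀ {l} → IsPartition n l → ¬ (x ∷ M ⊆ₘ l)
  too-big (_ , parts , refl) (x∈ ∷ _) = x≰n (∈⇒≤ (PartsBelow-sum parts) x∈)
... | yes x≤n with n′ , refl ← m≤n⇒∃[o]m+o≡n x≤n = begin
  length (filter (x ∷ M ⊆ₘ?_) (partitions (x + n′)))
    ≡⟨ count-partitions-by-inverses (x ∷ M ⊆ₘ?_) (M ⊆ₘ?_) (removePart x) (insertPart x)
         remove-maps insert-maps
         (λ where (_ , parts , _) (x∈ ∷ _) → insertPart-removePart parts x∈)
         (λ {μ} _ _ → removePart-insertPart x μ) ⟩
  length (filter (M ⊆ₘ?_) (partitions n′))   ≡⟨ count-⊆ₘ M M⁺ n′ ⟩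
  p⊖ n′ (sum M)                               ≡⟨ p⊖-+ x n′ (sum M) ⟨
  p⊖ (x + n′) (x + sum M)                     ∎
  where
  open ≡-Reasoning
  remove-maps : ∀ {l} → IsPartition (x + n′) l → x ∷ M ⊆ₘ l → IsPartition n′ (removePart x l) × M ⊆ₘ removePart x l
  remove-maps (b , parts , sum≡) (x∈ ∷ M⊆) =
    (b , PartsBelow-removePart x parts , +-cancelˡ-≡ x _ _ (trans (sum-removePart x∈) sum≡)) , M⊆
  insert-maps : ∀ {μ} → IsPartition n′ μ → M ⊆ₘ μ →
    IsPartition (x + n′) (insertPart x μ) × x ∷ M ⊆ₘ insertPart x μ
  insert-maps {μ} (b , parts , sum≡) M⊆ =
    (b + x , PartsBelow-insertPart (PartsBelow-mono (m≤m+n b x) parts) 1≤x (m≤n+m x b) ,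
     trans (sum-insertPart x μ) (cong (x +_) sum≡)) ,
    ∈-insertPart x μ ∷ subst (M ⊆ₘ_) (sym (removePart-insertPart x μ)) M⊆

-- Here and below, mult y (x ∷ l) unfolds to indicator (x ≟ y) + mult y l, as does (x ≟ y) computes to x ≡ᵇ y.
mult-removePart : ∀ {x l} → x ∈ l → ∀ y → mult y (removePart x l) + indicator (x ≟ y) ≡ mult y l
mult-removePart {x} {z ∷ zs} x∈ y with z ≟ x | x∈
... | yes refl | _          = +-comm (mult y zs) _
... | no  z≢x  | here refl  = ⊥-elim (z≢x refl)
... | no  _    | there x∈zs = trans (+-assoc (indicator (z ≟ y)) _ _) (cong (indicator (z ≟ y) +_) (mult-removePart x∈zs y))

∈⇒1≤mult : ∀ {x l} → x ∈ l → 1 ≤ mult x l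
∈⇒1≤mult {x} {l} x∈ = begin
  1                                              ≡⟨ indicator-yes (x ≟ x) refl ⟨
  indicator (x ≟ x)                              ≤⟨ m≤n+m _ _ ⟩
  mult x (removePart x l) + indicator (x ≟ x)    ≡⟨ mult-removePart x∈ x ⟩
  mult x l                                       ∎
  where open ≤-Reasoning

1≤mult⇒∈ : ∀ {x} l → 1 ≤ mult x l → x ∈ l
1≤mult⇒∈ {x} (y ∷ ys) 1≤mult with y ≟ x
... | yes refl = here refl
... | no  y≢x  = there (1≤mult⇒∈ ys (subst (λ i → 1 ≤ i + mult x ys) (indicator-no (y ≟ x) y≢x) 1≤mult))

⊆ₘ⇒mult≤ : ∀ {M l} → M ⊆ₘ l → ∀ y → mult y M ≤ mult y l
⊆ₘ⇒mult≤ []                        y = z≤n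
⊆ₘ⇒mult≤ {x ∷ M} {l} (x∈ ∷ M⊆) y = begin
  indicator (x ≟ y) + mult y M                  ≤⟨ +-monoʳ-≤ (indicator (x ≟ y)) (⊆ₘ⇒mult≤ M⊆ y) ⟩
  indicator (x ≟ y) + mult y (removePart x l)   ≡⟨ +-comm (indicator (x ≟ y)) _ ⟩
  mult y (removePart x l) + indicator (x ≟ y)   ≡⟨ mult-removePart x∈ y ⟩
  mult y l                                      ∎
  where open ≤-Reasoning

mult≤⇒⊆ₘ : ∀ M {l} → (∀ y → mult y M ≤ mult y l) → M ⊆ₘ l
mult≤⇒⊆ₘ []      _     = []
mult≤⇒⊆ₘ (x ∷ M) {l} M≤l = x∈ ∷ mult≤⇒⊆ₘ M λ y → +-cancelʳ-≤ (indicator (x ≟ y)) _ _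
  (subst₂ _≤_ (+-comm (indicator (x ≟ y)) (mult y M)) (sym (mult-removePart x∈ y)) (M≤l y))
  where
  x∈ : x ∈ l
  x∈ = 1≤mult⇒∈ l (≤-trans (≤-trans (≤-reflexive (sym (indicator-yes (x ≟ x) refl))) (m≤m+n _ _)) (M≤l x))

triples : ℕ → List ℕ
triples zero    = []
triples (suc j) = suc j ∷ suc j ∷ suc j ∷ triples j

pentagonalParts : ℕ → List ℕ
pentagonalParts zero    = []
pentagonalParts (suc j) = suc j ∷ suc j ∷ triples j

All-pentagonalParts : ∀ j → All (1 ≤_) (pentagonalParts j)
All-pentagonalParts zero    = All.[]
All-pentagonalParts (suc j) = s≤s z≤n All.∷ s≤s z≤n All.∷ All-triples j
  where
  All-triples : ∀ j → All (1 ≤_) (triples j)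
  All-triples zero    = All.[]
  All-triples (suc j) = s≤s z≤n All.∷ s≤s z≤n All.∷ s≤s z≤n All.∷ All-triples j

sum-pentagonalParts : ∀ j → sum (pentagonalParts j) ≡ pentagonal j
sum-pentagonalParts zero          = refl
sum-pentagonalParts (suc zero)    = refl
sum-pentagonalParts (suc (suc j)) = begin
  sum (pentagonalParts (suc (suc j)))                    ≡⟨ shuffle j (sum (triples j)) ⟩
  sum (pentagonalParts (suc j)) + suc (suc (3 * suc j))  ≡⟨ cong (_+ suc (suc (3 * suc j))) (sum-pentagonalParts (suc j)) ⟩
  pentagonal (suc (suc j))                               ∎
  where
  open ≡-Reasoning
  shuffle : ∀ j t → 2 + j + (2 + j + (1 + j + (1 + j + (1 + j + t)))) ≡ (1 + j + (1 + j + t)) + (2 + 3 * (1 + j))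
  shuffle = solve-∀

mult-triples-> : ∀ {j y} → j < y → mult y (triples j) ≡ 0
mult-triples-> {zero}  _   = refl
mult-triples-> {suc j} {y} j<y rewrite indicator-no (suc j ≟ y) (<⇒≢ j<y) = mult-triples-> {j} (<⇒≤ j<y)

mult-0-triples : ∀ j → mult 0 (triples j) ≡ 0
mult-0-triples zero    = refl
mult-0-triples (suc j) = mult-0-triples j

mult-triples-≤ : ∀ {j y} → 1 ≤ y → y ≤ j → mult y (triples j) ≡ 3
mult-triples-≤ {zero}  1≤y y≤0 with () ← ≤-trans 1≤y y≤0
mult-triples-≤ {suc j} {y} 1≤y y≤1+j with m≤n⇒m<n∨m≡n y≤1+j
... | inj₁ y<1+j rewrite indicator-no (suc j ≟ y) (≢-sym (<⇒≢ y<1+j)) = mult-triples-≤ 1≤y (≤-pred y<1+j)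
... | inj₂ refl  rewrite indicator-yes (suc j ≟ suc j) refl = cong (3 +_) (mult-triples-> {j} ≤-refl)

triples≤ : ∀ {j l} → (∀ i → 1 ≤ i → i ≤ j → 3 ≤ mult i l) → ∀ y → mult y (triples j) ≤ mult y l
triples≤ {j} {l} 3≤ zero    = ≤-trans (≤-reflexive (mult-0-triples j)) z≤n
triples≤ {j} {l} 3≤ (suc y) with suc y ≤? j
... | yes y<j = subst (_≤ mult (suc y) l) (sym (mult-triples-≤ (s≤s z≤n) y<j)) (3≤ (suc y) (s≤s z≤n) y<j)
... | no  y≮j = subst (_≤ mult (suc y) l) (sym (mult-triples-> (≰⇒> y≮j))) z≤n

pentagonalParts-⊆ₘ⁺ : ∀ {j l} → (∀ i → 1 ≤ i → i ≤ j → 3 ≤ mult i l) → 2 ≤ mult (suc j) l →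
  pentagonalParts (suc j) ⊆ₘ l
pentagonalParts-⊆ₘ⁺ {j} {l} 3≤ 2≤ = mult≤⇒⊆ₘ (pentagonalParts (suc j)) bound
  where
  bound : ∀ y → mult y (pentagonalParts (suc j)) ≤ mult y l
  bound y with suc j ≟ y
  ... | yes refl rewrite indicator-yes (suc j ≟ suc j) refl | mult-triples-> {j} ≤-refl = 2≤
  ... | no  j≢y  rewrite indicator-no (suc j ≟ y) j≢y = triples≤ {l = l} 3≤ y

pentagonalParts-⊆ₘ⁻ : ∀ {j l} → pentagonalParts (suc j) ⊆ₘ l →
  (∀ i → 1 ≤ i → i ≤ j → 3 ≤ mult i l) × 2 ≤ mult (suc j) l
pentagonalParts-⊆ₘ⁻ {j} {l} ⊆l = three , two
  where
  three : ∀ i → 1 ≤ i → i ≤ j → 3 ≤ mult i l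
  three i 1≤i i≤j = begin
    3                                      ≡⟨ mult-triples-≤ 1≤i i≤j ⟨
    mult i (triples j)                     ≤⟨ m≤n+m _ (indicator (suc j ≟ i) + indicator (suc j ≟ i)) ⟩
    (indicator (suc j ≟ i) + indicator (suc j ≟ i)) + mult i (triples j) ≡⟨ +-assoc (indicator (suc j ≟ i)) _ _ ⟩
    mult i (pentagonalParts (suc j))       ≤⟨ ⊆ₘ⇒mult≤ ⊆l i ⟩
    mult i l                               ∎
    where open ≤-Reasoning
  two : 2 ≤ mult (suc j) l
  two = subst (_≤ mult (suc j) l) two-copies (⊆ₘ⇒mult≤ ⊆l (suc j))
    where
    two-copies : mult (suc j) (pentagonalParts (suc j)) ≡ 2
    two-copies rewrite indicator-yes (suc j ≟ suc j) refl | mult-triples-> {j} ≤-refl = refl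

∈-removePart : ∀ {x y l} → y ≢ x → y ∈ l → y ∈ removePart x l
∈-removePart {x} {l = z ∷ zs} y≢x y∈ with z ≟ x | y∈
... | yes refl | here refl   = ⊥-elim (y≢x refl)
... | yes refl | there y∈zs  = y∈zs
... | no  _    | here refl   = here refl
... | no  _    | there y∈zs  = there (∈-removePart y≢x y∈zs)

length-removePart : ∀ {x l} → x ∈ l → suc (length (removePart x l)) ≡ length l
length-removePart {x} {z ∷ zs} x∈ with z ≟ x | x∈
... | yes _   | _          = refl
... | no  z≢x | here refl  = ⊥-elim (z≢x refl)
... | no  _   | there x∈zs = cong suc (length-removePart x∈zs)

all-present⇒≤length : ∀ K {l} → (∀ i → 1 ≤ i → i ≤ K → i ∈ l) → K ≤ length l
all-present⇒≤length zero    _       = z≤n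
all-present⇒≤length (suc K) {l} present = subst (suc K ≤_) (length-removePart K+1∈)
  (s≤s (all-present⇒≤length K λ i 1≤i i≤K →
    ∈-removePart (<⇒≢ (s≤s i≤K)) (present i 1≤i (m≤n⇒m≤1+n i≤K))))
  where
  K+1∈ : suc K ∈ l
  K+1∈ = present (suc K) (s≤s z≤n) ≤-refl

record IsLeastMultBelow (r : ℕ) (l : List ℕ) (k : ℕ) : Set where
  field
    positive  : 1 ≤ k
    earlier   : ∀ i → 1 ≤ i → i < k → r ≤ mult i l
    deficient : mult k l < r

gSearch-correct : ∀ {r l} fuel j → 1 ≤ r → 1 ≤ j → suc (length l) < fuel + j →
  (∀ i → 1 ≤ i → i < j → r ≤ mult i l) → IsLeastMultBelow r l (gSearch fuel j r l)
gSearch-correct {r} {l} zero (suc j) 1≤r _ l<j earlier = ⊥-elim (<⇒≱ l<j (s≤s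
  (all-present⇒≤length j λ i 1≤i i≤j → 1≤mult⇒∈ l (≤-trans 1≤r (earlier i 1≤i (s≤s i≤j))))))
gSearch-correct {r} {l} (suc fuel) j 1≤r 1≤j l<fuel+j earlier with mult j l <ᵇ r in found
... | true  = record { positive = 1≤j ; earlier = earlier ; deficient = <ᵇ⇒< (mult j l) r (subst T (sym found) _) }
... | false = gSearch-correct fuel (suc j) 1≤r (m≤n⇒m≤1+n 1≤j)
                (subst (suc (length l) <_) (sym (+-suc fuel j)) l<fuel+j) earlier′
  where
  earlier′ : ∀ i → 1 ≤ i → i < suc j → r ≤ mult i l
  earlier′ i 1≤i i<1+j with m≤n⇒m<n∨m≡n (≤-pred i<1+j)
  ... | inj₁ i<j  = earlier i 1≤i i<j
  ... | inj₂ refl = ≮⇒≥ λ i<r → subst T found (<⇒<ᵇ i<r)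

g-correct : ∀ {r} l → 1 ≤ r → IsLeastMultBelow r l (g r l)
g-correct l 1≤r = gSearch-correct (suc (length l)) 1 1≤r ≤-refl (≤-reflexive (sym (+-comm (suc (length l)) 1)))
  λ i 1≤i i<1 → ⊥-elim (<⇒≱ i<1 1≤i)

count-pentagonalParts-⊆ₘ : ∀ l N → g 3 l < N →
  sum (applyUpTo (λ j → indicator (pentagonalParts j ⊆ₘ? l)) N) ≡ g 3 l + indicator (g 3 l <? g 2 l)
count-pentagonalParts-⊆ₘ l N g₃<N = trans (sum-applyUpTo-step N g₃<N below above) (cong (g 3 l +_) at)
  where
  open IsLeastMultBelow (g-correct {3} l (s≤s z≤n))
    renaming (positive to g₃-pos; earlier to g₃-earlier; deficient to g₃-deficient)
  open IsLeastMultBelow (g-correct {2} l (s≤s z≤n))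
    renaming (positive to g₂-pos; earlier to g₂-earlier; deficient to g₂-deficient)
  below : ∀ j → j < g 3 l → indicator (pentagonalParts j ⊆ₘ? l) ≡ 1
  below zero    _     = refl
  below (suc j) j<g₃ = indicator-yes (pentagonalParts (suc j) ⊆ₘ? l) (pentagonalParts-⊆ₘ⁺
    (λ i 1≤i i≤j → g₃-earlier i 1≤i (≤-trans (s≤s i≤j) (<⇒≤ j<g₃)))
    (≤-trans (n≤1+n 2) (g₃-earlier (suc j) (s≤s z≤n) j<g₃)))
  above : ∀ j → g 3 l < j → indicator (pentagonalParts j ⊆ₘ? l) ≡ 0
  above (suc j) g₃<j = indicator-no (pentagonalParts (suc j) ⊆ₘ? l) λ ⊆l →
    <⇒≱ g₃-deficient (proj₁ (pentagonalParts-⊆ₘ⁻ ⊆l) (g 3 l) g₃-pos (≤-pred g₃<j))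
  at : indicator (pentagonalParts (g 3 l) ⊆ₘ? l) ≡ indicator (g 3 l <? g 2 l)
  at with g 3 l | g₃-pos | g₃-earlier | g₃-deficient
  ... | suc j | _ | earlier₃ | _ = indicator-⇔ (pentagonalParts (suc j) ⊆ₘ? l) (suc j <? g 2 l) to from
    where
    to : pentagonalParts (suc j) ⊆ₘ l → suc j < g 2 l
    to ⊆l = ≰⇒> g₂≰ where
      g₂≰ : ¬ g 2 l ≤ suc j
      g₂≰ g₂≤ with m≤n⇒m<n∨m≡n g₂≤
      ... | inj₁ g₂<g₃ = <⇒≱ g₂-deficient (≤-trans (n≤1+n 2) (earlier₃ (g 2 l) g₂-pos g₂<g₃))
      ... | inj₂ g₂≡g₃ = <⇒≱ g₂-deficient (subst (λ i → 2 ≤ mult i l) (sym g₂≡g₃) (proj₂ (pentagonalParts-⊆ₘ⁻ ⊆l)))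
    from : suc j < g 2 l → pentagonalParts (suc j) ⊆ₘ l
    from j<g₂ = pentagonalParts-⊆ₘ⁺ (λ i 1≤i i≤j → earlier₃ i 1≤i (s≤s i≤j))
                                    (g₂-earlier (suc j) (s≤s z≤n) j<g₂)

g≤1+length : ∀ {r} l → 1 ≤ r → g r l ≤ suc (length l)
g≤1+length {r} l 1≤r with g r l | g-correct l 1≤r
... | suc k | record { earlier = earlier } = s≤s (all-present⇒≤length k λ i 1≤i i≤k →
  1≤mult⇒∈ l (≤-trans 1≤r (earlier i 1≤i (s≤s i≤k))))

S₃+G₃≡pentagonalSums : ∀ n → S₃ n + G₃ n ≡ evenPentagonalSum n + oddPentagonalSum n
S₃+G₃≡pentagonalSums n = begin
  S₃ n + G₃ n
    ≡⟨ cong (sum (map (g 3) L) +_) (sum-map-indicator g₃<g₂? L) ⟨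
  sum (map (g 3) L) + sum (map (λ l → indicator (g₃<g₂? l)) L)
    ≡⟨ sum-map-+ (g 3) (λ l → indicator (g₃<g₂? l)) L ⟨
  sum (map (λ l → g 3 l + indicator (g₃<g₂? l)) L)
    ≡⟨ cong sum (map-cong-local (All.tabulate λ {l} l∈ → sym (count-pentagonalParts-⊆ₘ l N (g₃<N l∈)))) ⟩
  sum (map (λ l → sum (applyUpTo (λ j → indicator (pentagonalParts j ⊆ₘ? l)) N)) L)
    ≡⟨ sum-map-applyUpTo-comm (λ l j → indicator (pentagonalParts j ⊆ₘ? l)) N L ⟩
  sum (applyUpTo (λ j → sum (map (λ l → indicator (pentagonalParts j ⊆ₘ? l)) L)) N)
    ≡⟨ sum-applyUpTo-cong N (λ j → sum-map-indicator (pentagonalParts j ⊆ₘ?_) L) ⟩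
  sum (applyUpTo (λ j → length (filter (pentagonalParts j ⊆ₘ?_) L)) N)
    ≡⟨ sum-applyUpTo-cong N (λ j → trans (count-⊆ₘ (pentagonalParts j) (All-pentagonalParts j) n)
                                         (cong (p⊖ n) (sum-pentagonalParts j))) ⟩
  sum (applyUpTo (λ j → p⊖ n (pentagonal j)) N)
    ≡⟨ sum-applyUpTo-even-odd (λ j → p⊖ n (pentagonal j)) (suc n) ⟩
  evenPentagonalSum n + oddPentagonalSum n ∎
  where
  open ≡-Reasoning
  L = partitions n
  N = suc n + suc n
  g₃<g₂? : Decidable (λ l → g 3 l < g 2 l)
  g₃<g₂? l = g 3 l <? g 2 l
  g₃<N : ∀ {l} → l ∈ L → g 3 l < N
  g₃<N {l} l∈ with _ , parts , sum≡ ← ∈-partitions⁻ l∈ =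
    s≤s (≤-trans (g≤1+length l (s≤s z≤n))
                 (≤-trans (s≤s (≤-trans (length≤sum parts) (≤-reflexive sum≡))) (m≤n+m (suc n) n)))

Σ≤≡sum-applyUpTo : ∀ n f → Σ≤ n f ≡ sum (applyUpTo f (suc n))
Σ≤≡sum-applyUpTo n f = cong sum (map-upTo f (suc n))

double-from-sum-and-difference : ∀ {a b r s} → r + b ≡ a → s ≡ a + b → 2 * a ≡ s + r × 2 * b + r ≡ s
double-from-sum-and-difference {b = b} {r} refl refl = identity₁ r b , identity₂ r b
  where
  identity₁ : ∀ r b → 2 * (r + b) ≡ (r + b) + b + r
  identity₁ = solve-∀
  identity₂ : ∀ r b → 2 * b + r ≡ (r + b) + b
  identity₂ = solve-∀

open import Data.Integer using (+_) renaming (_-_ to _-ℤ_)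

corollary6 : (n : ℕ) →
    (2 * Σ≤ n (λ k → p (+ n -ℤ + (k * (6 * k + 1)))) ≡ S₃ n + G₃ n + R n)
    × (2 * Σ≤ n (λ k → p (+ n -ℤ + ((2 * k + 1) * (3 * k + 2)))) + R n ≡ S₃ n + G₃ n)
corollary6 n = trans (cong (2 *_) evens) doubled-even , trans (cong (λ t → 2 * t + R n) odds) doubled-odd
  where
  doubled = double-from-sum-and-difference (R+odd≡even n) (S₃+G₃≡pentagonalSums n)
  doubled-even = proj₁ doubled
  doubled-odd  = proj₂ doubled
  evens : Σ≤ n (λ k → p (+ n -ℤ + (k * (6 * k + 1)))) ≡ evenPentagonalSum n
  evens = trans (Σ≤≡sum-applyUpTo n _) (sum-applyUpTo-cong (suc n) λ k →
    trans (p-⊖ n (k * (6 * k + 1))) (cong (p⊖ n) (sym (pentagonal-even k))))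
  odds : Σ≤ n (λ k → p (+ n -ℤ + ((2 * k + 1) * (3 * k + 2)))) ≡ oddPentagonalSum n
  odds = trans (Σ≤≡sum-applyUpTo n _) (sum-applyUpTo-cong (suc n) λ k →
    trans (p-⊖ n ((2 * k + 1) * (3 * k + 2))) (cong (p⊖ n) (sym (pentagonal-odd k))))
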